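{- If $n, r \geq 1$, then the following holds: \begin{enumerate} \item The generalized replacement product of $^G\Gamma_n$ and $^G\Gamma_r$ is isomorphic to $^G\Gamma_{n+r}$ (via the map $(v,u)\mapsto uv$, $v\in X^n$, $u\in X^r$). \item $^G\Gamma_{n+r}$ is an unramified, $d^n$ sheeted graph covering of $^G\Gamma_r$ (via the map $uv \mapsto u$). \end{enumerate}
   Context: Let $G$ be a self-similar group generated by a bounded automaton $\mathcal{A}$ with finite generating set of states $S$ (closed under inverses) acting on the rooted tree $X^*$ over a finite alphabet $X$ with $|X| = d$; for $g\in G$ and a word $u$, $g|_u$ denotes the restriction (section), so that $g(uw)=g(u)\,g|_u(w)$. For each $n$, $^G\Gamma_n$ denotes the Schreier graph of the action of $G$ on $X^n$ (vertices $X^n$, $u$ adjacent to $s(u)$ for $s \in S$), and $^G\Gamma_n'$ denotes the tile graph, the subgraph of $^G\Gamma_n$ keeping only the edges $\{u,s(u)\}$ with $s|_u = \mathds{1}$; the tile graphs are assumed connected. The generalized replacement product of $^G\Gamma_n$ and $^G\Gamma_r$ is the $|S|$-regular graph with vertex set $X^n \times X^r$ whose edges are given by the rotation map: for $(v,u) \in X^n \times X^r$ and $s\in S$, $(v,u)$ with color $s$ is sent to $((v,s(u)),s^{ -1})$ if $s|_u = \mathds{1}$, and to $((s|_u(v),s(u)),s^{ -1})$ if $s|_u \neq \mathds{1}$ (whether or not $s|_{uv} = \mathds{1}$). -}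

module Defs where

open import Data.Nat using (ℕ; _≤_; _+_; _^_)
open import Data.Fin using (Fin)
open import Data.Vec using (Vec; []; _∷_; _++_; take)
open import Data.List using (List; length)
open import Data.List.Relation.Unary.All using (All)
open import Data.List.Relation.Unary.Unique.Propositional using (Unique)
open import Data.Product using (Σ; ∃; _×_; _,_)
open import Data.Sum using (_⊎_)
open import Relation.Nullary using (¬_)
open import Relation.Binary.PropositionalEquality using (_≡_)
open import Relation.Binary.Construct.Closure.ReflexiveTransitive using (Star)
open import Relation.Binary.Construct.Closure.Symmetric using (SymClosure)
open import Function.Definitions using (Injective; Bijective)
open import Function.Bundles using (_↔_; _⇔_)

-- Words over the alphabet X = Fin d; X^n = Vec (Fin d) n.
-- A word u = x₁ x₂ … xₙ is a vector with x₁ at the head.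

Word : ℕ → ℕ → Set
Word d n = Vec (Fin d) n

-- A finite (invertible, Mealy) automaton over X = Fin d together with a
-- finite generating set S = Fin k of its states, closed under inverses.

record Setup (d : ℕ) : Set where
  field
    m    : ℕ
    out  : Fin m → Fin d → Fin d
    next : Fin m → Fin d → Fin m
    out-perm : (q : Fin m) → Injective _≡_ _≡_ (out q)
    k    : ℕ
    gen  : Fin k → Fin m
    gen-inj : Injective _≡_ _≡_ gen
    inv  : Fin k → Fin k

module _ {d : ℕ} (A : Setup d) where
  open Setup A

  act : ∀ {n} → Fin m → Word d n → Word d n
  act q []       = []
  act q (x ∷ w)  = out q x ∷ act (next q x) w

  section : ∀ {n} → Fin m → Word d n → Fin m
  section q []      = q
  section q (x ∷ u) = section (next q x) u

  Trivial : Fin m → Set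
  Trivial q = ∀ n (w : Word d n) → act q w ≡ w

  InverseClosed : Set
  InverseClosed = ∀ (s : Fin k) n (w : Word d n) →
                  act (gen (inv s)) (act (gen s) w) ≡ w

  Bounded : Set
  Bounded = ∀ (q : Fin m) → Σ ℕ λ C → ∀ n (us : List (Word d n)) →
            Unique us → All (λ u → ¬ Trivial (section q u)) us → length us ≤ C

  TileStep : ∀ n → Word d n → Word d n → Set
  TileStep n u w = Σ (Fin k) λ s → Trivial (section (gen s) u) × act (gen s) u ≡ w

  TilesConnected : Set
  TilesConnected = ∀ n (u w : Word d n) → Star (SymClosure (TileStep n)) u w

  -- S-labelled graphs given by (relational) rotation maps:
  -- R x s y t  means  Rot(x, s) = (y, t).

  Schreier : ∀ n → Word d n → Fin k → Word d n → Fin k → Set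
  Schreier n u s u' t = (act (gen s) u ≡ u') × (inv s ≡ t)

  Replacement : ∀ n r → Word d n × Word d r → Fin k →
                Word d n × Word d r → Fin k → Set
  Replacement n r (v , u) s (v' , u') t =
    (inv s ≡ t) × (act (gen s) u ≡ u') ×
    ((Trivial (section (gen s) u) × v' ≡ v) ⊎
     (¬ Trivial (section (gen s) u) × v' ≡ act (section (gen s) u) v))

  IsoVia : {V W : Set} → (V → Fin k → V → Fin k → Set) →
           (W → Fin k → W → Fin k → Set) → (V → W) → Set
  IsoVia R₁ R₂ φ = Bijective _≡_ _≡_ φ ×
                   (∀ x s y t → R₁ x s y t ⇔ R₂ (φ x) s (φ y) t)

  -- p : R₁ → R₂ is an unramified covering with `sheets` sheets:
  -- a label-preserving graph morphism, bijective on the edges around every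
  -- vertex (unramified), each fibre having exactly `sheets` elements.
  IsCoveringVia : {V W : Set} → (V → Fin k → V → Fin k → Set) →
                  (W → Fin k → W → Fin k → Set) → (V → W) → ℕ → Set
  IsCoveringVia {V} {W} R₁ R₂ p sheets =
    (∀ x s y t → R₁ x s y t → R₂ (p x) s (p y) t) ×
    (∀ x s y' t → R₂ (p x) s y' t → Σ V λ y → R₁ x s y t × p y ≡ y') ×
    (∀ x s y₁ y₂ t → R₁ x s y₁ t → R₁ x s y₂ t → p y₁ ≡ p y₂ → y₁ ≡ y₂) ×
    (∀ (w : W) → Fin sheets ↔ Σ V λ x → p x ≡ w)

  concatMap : ∀ n r → Word d n × Word d r → Word d (r + n)
  concatMap n r (v , u) = u ++ v

  prefixMap : ∀ n r → Word d (r + n) → Word d r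
  prefixMap n r w = take r w

-- A state s acts on a word uv (u ∈ Xʳ, v ∈ Xⁿ) by s(uv) = s(u) s|_u(v), which is literally the
-- rotation map of the generalized replacement product: its two cases agree because a trivial
-- section fixes v.  Since s(uv) has prefix s(u), deleting the last n letters is a label-preserving
-- map ^GΓ_{r+n} → ^GΓ_r, bijective on the edges at every vertex, with fibres ≅ Xⁿ.
-- Choosing the case of the rotation map constructively needs triviality of a state of a finite
-- automaton to be decidable: the sets of states acting trivially on Xʲ decrease with j, hence
-- stabilise, and from then on they are exactly the trivial states.
module Submission where

open import Defs
open import Data.Nat using (ℕ; _≤_; _+_; _^_)
open import Data.Product using (_×_)

open import Data.Nat using (zero; suc; z≤n; s≤s)
open import Data.Nat.Properties using (n≤1+n; m≤m+n)
open import Data.Unit using (⊤; tt)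
open import Data.Fin using (Fin; _≟_)
open import Data.Fin.Properties using (any?; all?)
open import Data.Fin.Subset using (Subset; _∈_; _⊂_)
open import Data.Fin.Subset.Induction using (⊂-wellFounded)
open import Data.Vec using (Vec; []; _∷_; _++_; take; drop; tabulate)
open import Data.Vec.Properties
  using (take++drop≡id; ++-injective; ++-injectiveˡ; ++-injectiveʳ; ∷-injectiveˡ; ∷-injectiveʳ;
         lookup∘tabulate; lookup⇒[]=; []=⇒lookup)
import Data.Vec.Properties as Vec
open import Data.Vec.Recursive using (Fin[m^n]↔Fin[m]^n)
open import Data.Vec.Recursive.Properties using (↔Vec)
open import Data.Product using (Σ; ∃; _,_; proj₁; proj₂)
open import Data.Product.Properties using (Σ-≡,≡→≡)
open import Data.Sum using (_⊎_; inj₁; inj₂)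
open import Function using (_∘_)
open import Function.Definitions using (Bijective)
open import Function.Bundles using (_↔_; _⇔_; Equivalence; mk⇔; mk↔ₛ′)
open import Function.Properties.Inverse using (↔-trans)
open import Induction.WellFounded using (Acc; acc)
open import Relation.Binary.Definitions using (DecidableEquality)
open import Relation.Binary.PropositionalEquality
open import Relation.Nullary using (¬_; yes; no; does)
open import Relation.Nullary.Decidable using (dec-true; decidable-stable; map′; ¬?; _×-dec_)
open import Relation.Unary using (Pred; Decidable; _⊆_)
open import Axiom.UniquenessOfIdentityProofs using (module Decidable⇒UIP)

module _ {m ℓ} {P : Pred (Fin m) ℓ} (P? : Decidable P) where

  extent : Subset m
  extent = tabulate (does ∘ P?)

  ∈-extent⁺ : ∀ {q} → P q → q ∈ extent
  ∈-extent⁺ {q} p = lookup⇒[]= q extent (trans (lookup∘tabulate (does ∘ P?) q) (dec-true (P? q) p))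

  ∈-extent⁻ : ∀ {q} → q ∈ extent → P q
  ∈-extent⁻ {q} q∈ with P? q | trans (sym (lookup∘tabulate (does ∘ P?) q)) ([]=⇒lookup q∈)
  ... | yes p | _ = p

descending-stabilises : ∀ {m ℓ} (P : ℕ → Pred (Fin m) ℓ) → (∀ j → Decidable (P j)) →
                        (∀ j → P (suc j) ⊆ P j) → ∃ λ j → P j ⊆ P (suc j)
descending-stabilises P P? P-anti = go 0 (⊂-wellFounded (extent (P? 0)))
  where
  go : ∀ i → Acc _⊂_ (extent (P? i)) → ∃ λ j → P j ⊆ P (suc j)
  go i (acc smaller) with any? (λ q → P? i q ×-dec ¬? (P? (suc i) q))
  ... | yes (q , p , ¬p′) = go (suc i) (smaller shrinks)
    where
    shrinks : extent (P? (suc i)) ⊂ extent (P? i)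
    shrinks = ∈-extent⁺ (P? i) ∘ P-anti i ∘ ∈-extent⁻ (P? (suc i)) ,
              q , ∈-extent⁺ (P? i) p , ¬p′ ∘ ∈-extent⁻ (P? (suc i))
  ... | no none = i , λ {q} p → decidable-stable (P? (suc i) q) (λ ¬p′ → none (q , p , ¬p′))

module _ {a} {A : Set a} where

  take-++ : ∀ {r n} (u : Vec A r) (v : Vec A n) → take r (u ++ v) ≡ u
  take-++ []      v = refl
  take-++ (x ∷ u) v = cong (x ∷_) (take-++ u v)

  drop-++ : ∀ {r n} (u : Vec A r) (v : Vec A n) → drop r (u ++ v) ≡ v
  drop-++ []      v = refl
  drop-++ (x ∷ u) v = drop-++ u v

  drop↔take-fibre : DecidableEquality A → ∀ {n r} (w : Vec A r) →
                    Vec A n ↔ Σ (Vec A (r + n)) λ x → take r x ≡ w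
  drop↔take-fibre _≟ᴬ_ {r = r} w =
    mk↔ₛ′ (λ v → w ++ v , take-++ w v) (drop r ∘ proj₁) w++drop (drop-++ w)
    where
    open Decidable⇒UIP (Vec.≡-dec _≟ᴬ_)
    w++drop : ∀ p → (w ++ drop r (proj₁ p) , take-++ w (drop r (proj₁ p))) ≡ p
    w++drop (x , refl) = Σ-≡,≡→≡ (take++drop≡id r x , ≡-irrelevant _ _)

Fin[d^n]↔Word : ∀ d n → Fin (d ^ n) ↔ Word d n
Fin[d^n]↔Word d n = ↔-trans (Fin[m^n]↔Fin[m]^n d n) (↔Vec n)

module _ {d : ℕ} (A : Setup d) where
  open Setup A

  act-++ : ∀ {r n} q (u : Word d r) (v : Word d n) →
           act A q (u ++ v) ≡ act A q u ++ act A (section A q u) v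
  act-++ q []      v = refl
  act-++ q (x ∷ u) v = cong (out q x ∷_) (act-++ (next q x) u v)

  take-act : ∀ r {n} q (w : Word d (r + n)) → take r (act A q w) ≡ act A q (take r w)
  take-act zero    q w       = refl
  take-act (suc r) q (x ∷ w) = cong (out q x ∷_) (take-act r (next q x) w)

  TrivialOnLevel : ℕ → Fin m → Set
  TrivialOnLevel zero    q = ⊤
  TrivialOnLevel (suc j) q = ∀ x → out q x ≡ x × TrivialOnLevel j (next q x)

  trivialOnLevel? : ∀ j → Decidable (TrivialOnLevel j)
  trivialOnLevel? zero    q = yes tt
  trivialOnLevel? (suc j) q = all? λ x → (out q x ≟ x) ×-dec trivialOnLevel? j (next q x)

  trivialOnLevel-antitone : ∀ {i j} → i ≤ j → TrivialOnLevel j ⊆ TrivialOnLevel i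
  trivialOnLevel-antitone z≤n       _ = tt
  trivialOnLevel-antitone (s≤s i≤j) t x = proj₁ (t x) , trivialOnLevel-antitone i≤j (proj₂ (t x))

  trivialOnLevel-fixes : ∀ {j q} → TrivialOnLevel j q → (w : Word d j) → act A q w ≡ w
  trivialOnLevel-fixes t []      = refl
  trivialOnLevel-fixes t (x ∷ w) = cong₂ _∷_ (proj₁ (t x)) (trivialOnLevel-fixes (proj₂ (t x)) w)

  trivial-next : ∀ {q} → Trivial A q → ∀ x → out q x ≡ x × Trivial A (next q x)
  trivial-next t x = ∷-injectiveˡ (t 1 (x ∷ [])) , λ n w → ∷-injectiveʳ (t (suc n) (x ∷ w))

  trivial⇒trivialOnLevel : ∀ j {q} → Trivial A q → TrivialOnLevel j q
  trivial⇒trivialOnLevel zero    t = tt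
  trivial⇒trivialOnLevel (suc j) t x =
    proj₁ (trivial-next t x) , trivial⇒trivialOnLevel j (proj₂ (trivial-next t x))

  trivialOnLevel-persists : ∀ {j} → TrivialOnLevel j ⊆ TrivialOnLevel (suc j) →
                            ∀ t → TrivialOnLevel j ⊆ TrivialOnLevel (t + j)
  trivialOnLevel-persists stable zero    p   = p
  trivialOnLevel-persists stable (suc t) p x =
    proj₁ (stable p x) , trivialOnLevel-persists stable t (proj₂ (stable p x))

  trivial? : Decidable (Trivial A)
  trivial? q with descending-stabilises TrivialOnLevel trivialOnLevel?
                   (λ j → trivialOnLevel-antitone (n≤1+n j))
  ... | j , stable = map′ trivialOnLevel⇒trivial (trivial⇒trivialOnLevel j) (trivialOnLevel? j q)
    where
    trivialOnLevel⇒trivial : TrivialOnLevel j q → Trivial A q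
    trivialOnLevel⇒trivial t n = trivialOnLevel-fixes
      (trivialOnLevel-antitone (m≤m+n n j) (trivialOnLevel-persists stable n t))

  rotationCases⇔act : ∀ {n} q (v v′ : Word d n) →
    ((Trivial A q × v′ ≡ v) ⊎ (¬ Trivial A q × v′ ≡ act A q v)) ⇔ act A q v ≡ v′
  rotationCases⇔act q v v′ = mk⇔ to from
    where
    to : (Trivial A q × v′ ≡ v) ⊎ (¬ Trivial A q × v′ ≡ act A q v) → act A q v ≡ v′
    to (inj₁ (t , v′≡v))  = trans (t _ v) (sym v′≡v)
    to (inj₂ (_ , v′≡qv)) = sym v′≡qv
    from : act A q v ≡ v′ → (Trivial A q × v′ ≡ v) ⊎ (¬ Trivial A q × v′ ≡ act A q v)
    from qv≡v′ with trivial? q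
    ... | yes t = inj₁ (t , trans (sym qv≡v′) (t _ v))
    ... | no ¬t = inj₂ (¬t , sym qv≡v′)

  concat-bijective : ∀ n r → Bijective _≡_ _≡_ (concatMap A n r)
  concat-bijective n r =
    (λ {(v , u)} {(v′ , u′)} uv≡u′v′ →
       cong₂ _,_ (++-injectiveʳ u u′ uv≡u′v′) (++-injectiveˡ u u′ uv≡u′v′)) ,
    λ w → (drop r w , take r w) , λ { refl → take++drop≡id r w }

  replacement⇔schreier : ∀ n r x s y t →
    Replacement A n r x s y t ⇔ Schreier A (r + n) (concatMap A n r x) s (concatMap A n r y) t
  replacement⇔schreier n r (v , u) s (v′ , u′) t = mk⇔ to from
    where
    open Equivalence (rotationCases⇔act (section A (gen s) u) v v′)
      renaming (to to cases⇒act; from to act⇒cases)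
    to : Replacement A n r (v , u) s (v′ , u′) t → Schreier A (r + n) (u ++ v) s (u′ ++ v′) t
    to (s⁻¹≡t , su≡u′ , cases) =
      trans (act-++ (gen s) u v) (cong₂ _++_ su≡u′ (cases⇒act cases)) , s⁻¹≡t
    from : Schreier A (r + n) (u ++ v) s (u′ ++ v′) t → Replacement A n r (v , u) s (v′ , u′) t
    from (suv≡u′v′ , s⁻¹≡t) with ++-injective _ u′ (trans (sym (act-++ (gen s) u v)) suv≡u′v′)
    ... | su≡u′ , s|ᵤv≡v′ = s⁻¹≡t , su≡u′ , act⇒cases s|ᵤv≡v′

  prefix-preserves-edges : ∀ n r x s y t →
    Schreier A (r + n) x s y t → Schreier A r (prefixMap A n r x) s (prefixMap A n r y) t
  prefix-preserves-edges n r x s y t (sx≡y , s⁻¹≡t) =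
    trans (sym (take-act r (gen s) x)) (cong (take r) sx≡y) , s⁻¹≡t

  prefix-lifts-edges : ∀ n r x s y′ t → Schreier A r (prefixMap A n r x) s y′ t →
    Σ (Word d (r + n)) λ y → Schreier A (r + n) x s y t × prefixMap A n r y ≡ y′
  prefix-lifts-edges n r x s y′ t (sx≡y′ , s⁻¹≡t) =
    act A (gen s) x , (refl , s⁻¹≡t) , trans (take-act r (gen s) x) sx≡y′

  schreier-functional : ∀ n x s y₁ y₂ t → Schreier A n x s y₁ t → Schreier A n x s y₂ t → y₁ ≡ y₂
  schreier-functional n x s y₁ y₂ t (sx≡y₁ , _) (sx≡y₂ , _) = trans (sym sx≡y₁) sx≡y₂

  prefix-fibre↔ : ∀ n r (w : Word d r) →
                  Fin (d ^ n) ↔ Σ (Word d (r + n)) λ x → prefixMap A n r x ≡ w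
  prefix-fibre↔ n r w = ↔-trans (Fin[d^n]↔Word d n) (drop↔take-fibre _≟_ w)

mainTheorem3 : (d : ℕ) (A : Setup d) → InverseClosed A → Bounded A → TilesConnected A →
               (n r : ℕ) → 1 ≤ n → 1 ≤ r →
               IsoVia A (Replacement A n r) (Schreier A (r + n)) (concatMap A n r)
               × IsCoveringVia A (Schreier A (r + n)) (Schreier A r) (prefixMap A n r) (d ^ n)
mainTheorem3 d A _ _ _ n r _ _ =
  (concat-bijective A n r , replacement⇔schreier A n r) ,
  prefix-preserves-edges A n r ,
  prefix-lifts-edges A n r ,
  (λ x s y₁ y₂ t e₁ e₂ _ → schreier-functional A (r + n) x s y₁ y₂ t e₁ e₂) ,
  prefix-fibre↔ A n r
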